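{- (Confluence, for untyped terms.) For all terms $t_1,t_2,t_3$: if $t_1\twoheadrightarrow t_2$ and $t_1\twoheadrightarrow t_3$, then there exists a term $t_4$ such that $t_2\twoheadrightarrow t_4$ and $t_3\twoheadrightarrow t_4$.
   Context: Calculus $\lambda^{::}_{\mathtt{catch}}$ (untyped terms). Terms: $t,r,s ::= x \mid () \mid \mathtt{nil} \mid (::) \mid \mathtt{lrec} \mid \lambda x.r \mid t\,s \mid \mathtt{catch}\,\alpha\,t \mid \mathtt{throw}\,\alpha\,t$ ($x$ variables, $\alpha,\beta$ continuation variables; $\lambda x$ binds $x$, $\mathtt{catch}\,\alpha$ binds $\alpha$; terms modulo renaming of bound variables; application left-associative; $t::r$ abbreviates $(::)\,t\,r$). $\mathrm{FCV}$ = free continuation variables, $t[x:=r]$ capture-avoiding substitution. Values: $v,w ::= x \mid () \mid \mathtt{nil} \mid (::) \mid (::)\,v \mid (::)\,v\,w \mid \mathtt{lrec} \mid \mathtt{lrec}\,v \mid \mathtt{lrec}\,v\,w \mid \lambda x.r$. Contexts $E ::= \Box\,t \mid v\,\Box \mid \mathtt{throw}\,\alpha\,\Box$. One-step reduction $\to$ is the compatible closure (closure under all term constructors) of: $(\lambda x.t)\,v\to t[x:=v]$; $E[\mathtt{throw}\,\alpha\,t]\to\mathtt{throw}\,\alpha\,t$; $\mathtt{catch}\,\alpha\,(\mathtt{throw}\,\alpha\,t)\to\mathtt{catch}\,\alpha\,t$; $\mathtt{catch}\,\alpha\,(\mathtt{throw}\,\beta\,v)\to\mathtt{throw}\,\beta\,v$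 if $\alpha\notin\{\beta\}\cup\mathrm{FCV}(v)$; $\mathtt{catch}\,\alpha\,v\to v$ if $\alpha\notin\mathrm{FCV}(v)$; $\mathtt{lrec}\,v_r\,v_s\,\mathtt{nil}\to v_r$; $\mathtt{lrec}\,v_r\,v_s\,(v_h::v_t)\to v_s\,v_h\,v_t\,(\mathtt{lrec}\,v_r\,v_s\,v_t)$. $\twoheadrightarrow$ is the reflexive-transitive closure of $\to$. -}

module Defs where

-- Calculus λ^{::}_catch, untyped terms, with bound variables represented by
-- de Bruijn indices (terms modulo renaming of bound variables).
-- Two independent index spaces: term variables x (bound by lam) and
-- continuation variables α (bound by catch).

open import Data.Nat using (ℕ; zero; suc)
open import Function using (_∘_)
open import Relation.Binary.Construct.Closure.ReflexiveTransitive using (Star)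

data Tm : Set where
  var   : ℕ → Tm
  unit  : Tm
  nil   : Tm
  cons  : Tm
  lrec  : Tm
  lam   : Tm → Tm
  app   : Tm → Tm → Tm
  catch : Tm → Tm
  throw : ℕ → Tm → Tm     -- throw α t (α a continuation index)

_∷ₜ_ : Tm → Tm → Tm
t ∷ₜ r = app (app cons t) r

ext : (ℕ → ℕ) → (ℕ → ℕ)
ext ρ zero    = zero
ext ρ (suc n) = suc (ρ n)

renV : (ℕ → ℕ) → Tm → Tm
renV ρ (var x)     = var (ρ x)
renV ρ unit        = unit
renV ρ nil         = nil
renV ρ cons        = cons
renV ρ lrec        = lrec
renV ρ (lam t)     = lam (renV (ext ρ) t)
renV ρ (app t s)   = app (renV ρ t) (renV ρ s)
renV ρ (catch t)   = catch (renV ρ t)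
renV ρ (throw α t) = throw α (renV ρ t)

renK : (ℕ → ℕ) → Tm → Tm
renK ρ (var x)     = var x
renK ρ unit        = unit
renK ρ nil         = nil
renK ρ cons        = cons
renK ρ lrec        = lrec
renK ρ (lam t)     = lam (renK ρ t)
renK ρ (app t s)   = app (renK ρ t) (renK ρ s)
renK ρ (catch t)   = catch (renK (ext ρ) t)
renK ρ (throw α t) = throw (ρ α) (renK ρ t)

exts : (ℕ → Tm) → (ℕ → Tm)
exts σ zero    = var zero
exts σ (suc n) = renV suc (σ n)

sub : (ℕ → Tm) → Tm → Tm
sub σ (var x)     = σ x
sub σ unit        = unit
sub σ nil         = nil
sub σ cons        = cons
sub σ lrec        = lrec
sub σ (lam t)     = lam (sub (exts σ) t)
sub σ (app t s)   = app (sub σ t) (sub σ s)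
sub σ (catch t)   = catch (sub (renK suc ∘ σ) t)
sub σ (throw α t) = throw α (sub σ t)

single : Tm → (ℕ → Tm)
single v zero    = v
single v (suc n) = var n

_[_] : Tm → Tm → Tm
t [ v ] = sub (single v) t

data Value : Tm → Set where
  v-var   : ∀ x → Value (var x)
  v-unit  : Value unit
  v-nil   : Value nil
  v-cons0 : Value cons
  v-cons1 : ∀ {v} → Value v → Value (app cons v)
  v-cons2 : ∀ {v w} → Value v → Value w → Value (app (app cons v) w)
  v-lrec0 : Value lrec
  v-lrec1 : ∀ {v} → Value v → Value (app lrec v)
  v-lrec2 : ∀ {v w} → Value v → Value w → Value (app (app lrec v) w)
  v-lam   : ∀ r → Value (lam r)

-- one-step reduction: compatible closure of the rules
-- Side condition "α ∉ FCV(v)" for the outer binder catch α is expressed by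
-- writing the body as renK suc v (i.e. v does not mention index 0).
data _⟶_ : Tm → Tm → Set where
  β-lam      : ∀ {t v} → Value v → app (lam t) v ⟶ (t [ v ])
  -- E[throw α t] → throw α t, for E = □ s | v □ | throw β □
  throw-appL : ∀ {α t s} → app (throw α t) s ⟶ throw α t
  throw-appR : ∀ {v α t} → Value v → app v (throw α t) ⟶ throw α t
  throw-throw : ∀ {β α t} → throw β (throw α t) ⟶ throw α t
  catch-throw : ∀ {t} → catch (throw zero t) ⟶ catch t
  catch-other : ∀ {β v} → Value v →
                catch (throw (suc β) (renK suc v)) ⟶ throw β v
  catch-val  : ∀ {v} → Value v → catch (renK suc v) ⟶ v
  lrec-nil   : ∀ {vr vs} → Value vr → Value vs →
               app (app (app lrec vr) vs) nil ⟶ vr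
  lrec-cons  : ∀ {vr vs vh vt} → Value vr → Value vs → Value vh → Value vt →
               app (app (app lrec vr) vs) (vh ∷ₜ vt)
                 ⟶ app (app (app vs vh) vt) (app (app (app lrec vr) vs) vt)
  ξ-lam      : ∀ {t t'} → t ⟶ t' → lam t ⟶ lam t'
  ξ-appL     : ∀ {t t' s} → t ⟶ t' → app t s ⟶ app t' s
  ξ-appR     : ∀ {t s s'} → s ⟶ s' → app t s ⟶ app t s'
  ξ-catch    : ∀ {t t'} → t ⟶ t' → catch t ⟶ catch t'
  ξ-throw    : ∀ {α t t'} → t ⟶ t' → throw α t ⟶ throw α t'

_⟶*_ : Tm → Tm → Set
_⟶*_ = Star _⟶_

-- By the Z-property (Dehornoy and van Oostrom) a relation is confluent as soon as some map
-- dev satisfies t ⟶* dev t and, for every step t ⟶ t', t' ⟶* dev t ⟶* dev t'. Here dev is a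
-- complete development: it develops the immediate subterms and then contracts the root if it
-- has become a redex. Developing a value yields a value, so root redexes survive the
-- development of their subterms, and contraction commutes with value substitution up to ⟶*;
-- this gives both halves of the Z-property for β. The catch rules also need dev to commute
-- exactly with the weakening of continuation variables, which holds because a renaming with a
-- left inverse preserves and reflects root redexes.
module Submission where

open import Data.Bool using (Bool; true; false; _∨_)
open import Data.Bool.Properties using (∨-conicalˡ; ∨-conicalʳ)
open import Data.Empty using (⊥; ⊥-elim)
open import Data.Maybe using (Maybe; just; nothing; map; zipWith)
open import Data.Nat using (ℕ; zero; suc; pred; _≡ᵇ_)
open import Data.Product using (∃; ∃₂; _×_; _,_; proj₁; proj₂)
open import Function using (_∘_; id)
open import Relation.Binary.Core using (Rel)
open import Relation.Binary.PropositionalEquality hiding ([_])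
open import Relation.Binary.Construct.Closure.ReflexiveTransitive
  using (Star; ε; _◅_; _◅◅_; gmap; kleisliStar)
open import Relation.Binary.Construct.Closure.ReflexiveTransitive.Properties
  using (reflexive)
open import Relation.Binary.Rewriting using (Confluent)

open import Defs

Z⇒confluent : ∀ {a ℓ} {A : Set a} {_↝_ : Rel A ℓ} (f : A → A) →
              (∀ x → Star _↝_ x (f x)) →
              (∀ {x y} → x ↝ y → Star _↝_ y (f x) × Star _↝_ (f x) (f y)) →
              Confluent _↝_
Z⇒confluent {_↝_ = _↝_} f extensive z = confluent
  where
  monotone : ∀ {x y} → Star _↝_ x y → Star _↝_ (f x) (f y)
  monotone = kleisliStar f (proj₂ ∘ z)

  confluent : Confluent _↝_
  confluent ε xz = _ , xz , ε
  confluent (s ◅ ys) xz with confluent ys (proj₁ (z s) ◅◅ monotone xz)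
  ... | w , yw , fzw = w , yw , extensive _ ◅◅ fzw

ext-∘ : ∀ {ρ τ ζ} → ρ ∘ τ ≗ ζ → ext ρ ∘ ext τ ≗ ext ζ
ext-∘ e zero    = refl
ext-∘ e (suc n) = cong suc (e n)

ext-id : ∀ {ρ} → ρ ≗ id → ext ρ ≗ id
ext-id e zero    = refl
ext-id e (suc n) = cong suc (e n)

ext-inverse : ∀ {π ρ} → π ∘ ρ ≗ id → ext π ∘ ext ρ ≗ id
ext-inverse inv n = trans (ext-∘ inv n) (ext-id (λ _ → refl) n)

renV-renV : ∀ {ρ τ ζ} → ρ ∘ τ ≗ ζ → renV ρ ∘ renV τ ≗ renV ζ
renV-renV e (var x)     = cong var (e x)
renV-renV e unit        = refl
renV-renV e nil         = refl
renV-renV e cons        = refl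
renV-renV e lrec        = refl
renV-renV e (lam t)     = cong lam (renV-renV (ext-∘ e) t)
renV-renV e (app t s)   = cong₂ app (renV-renV e t) (renV-renV e s)
renV-renV e (catch t)   = cong catch (renV-renV e t)
renV-renV e (throw α t) = cong (throw α) (renV-renV e t)

renK-renK : ∀ {ρ τ ζ} → ρ ∘ τ ≗ ζ → renK ρ ∘ renK τ ≗ renK ζ
renK-renK e (var x)     = refl
renK-renK e unit        = refl
renK-renK e nil         = refl
renK-renK e cons        = refl
renK-renK e lrec        = refl
renK-renK e (lam t)     = cong lam (renK-renK e t)
renK-renK e (app t s)   = cong₂ app (renK-renK e t) (renK-renK e s)
renK-renK e (catch t)   = cong catch (renK-renK (ext-∘ e) t)
renK-renK e (throw α t) = cong₂ throw (e α) (renK-renK e t)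

renV-id : ∀ {ρ} → ρ ≗ id → renV ρ ≗ id
renV-id e (var x)     = cong var (e x)
renV-id e unit        = refl
renV-id e nil         = refl
renV-id e cons        = refl
renV-id e lrec        = refl
renV-id e (lam t)     = cong lam (renV-id (ext-id e) t)
renV-id e (app t s)   = cong₂ app (renV-id e t) (renV-id e s)
renV-id e (catch t)   = cong catch (renV-id e t)
renV-id e (throw α t) = cong (throw α) (renV-id e t)

renK-id : ∀ {ρ} → ρ ≗ id → renK ρ ≗ id
renK-id e (var x)     = refl
renK-id e unit        = refl
renK-id e nil         = refl
renK-id e cons        = refl
renK-id e lrec        = refl
renK-id e (lam t)     = cong lam (renK-id e t)
renK-id e (app t s)   = cong₂ app (renK-id e t) (renK-id e s)
renK-id e (catch t)   = cong catch (renK-id (ext-id e) t)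
renK-id e (throw α t) = cong₂ throw (e α) (renK-id e t)

renV-inverse : ∀ {π ρ} → π ∘ ρ ≗ id → renV π ∘ renV ρ ≗ id
renV-inverse e t = trans (renV-renV e t) (renV-id (λ _ → refl) t)

renK-inverse : ∀ {π ρ} → π ∘ ρ ≗ id → renK π ∘ renK ρ ≗ id
renK-inverse e t = trans (renK-renK e t) (renK-id (λ _ → refl) t)

renV-ext-suc : ∀ ρ t → renV (ext ρ) (renV suc t) ≡ renV suc (renV ρ t)
renV-ext-suc ρ t = trans (renV-renV (λ _ → refl) t) (sym (renV-renV (λ _ → refl) t))

renK-ext-suc : ∀ ρ t → renK (ext ρ) (renK suc t) ≡ renK suc (renK ρ t)
renK-ext-suc ρ t = trans (renK-renK (λ _ → refl) t) (sym (renK-renK (λ _ → refl) t))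

renV-renK : ∀ ρ τ → renV ρ ∘ renK τ ≗ renK τ ∘ renV ρ
renV-renK ρ τ (var x)     = refl
renV-renK ρ τ unit        = refl
renV-renK ρ τ nil         = refl
renV-renK ρ τ cons        = refl
renV-renK ρ τ lrec        = refl
renV-renK ρ τ (lam t)     = cong lam (renV-renK (ext ρ) τ t)
renV-renK ρ τ (app t s)   = cong₂ app (renV-renK ρ τ t) (renV-renK ρ τ s)
renV-renK ρ τ (catch t)   = cong catch (renV-renK ρ (ext τ) t)
renV-renK ρ τ (throw α t) = cong (throw (τ α)) (renV-renK ρ τ t)

sub-renV : ∀ {σ ρ τ} → σ ∘ ρ ≗ τ → sub σ ∘ renV ρ ≗ sub τ
sub-renV e (var x)     = e x
sub-renV e unit        = refl
sub-renV e nil         = refl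
sub-renV e cons        = refl
sub-renV e lrec        = refl
sub-renV {σ} {ρ} {τ} e (lam t) = cong lam (sub-renV exts-ext t)
  where exts-ext : exts σ ∘ ext ρ ≗ exts τ
        exts-ext zero    = refl
        exts-ext (suc n) = cong (renV suc) (e n)
sub-renV e (app t s)   = cong₂ app (sub-renV e t) (sub-renV e s)
sub-renV e (catch t)   = cong catch (sub-renV (cong (renK suc) ∘ e) t)
sub-renV e (throw α t) = cong (throw α) (sub-renV e t)

renV-sub : ∀ {ρ σ τ} → renV ρ ∘ σ ≗ τ → renV ρ ∘ sub σ ≗ sub τ
renV-sub e (var x)     = e x
renV-sub e unit        = refl
renV-sub e nil         = refl
renV-sub e cons        = refl
renV-sub e lrec        = refl
renV-sub {ρ} {σ} {τ} e (lam t) = cong lam (renV-sub ext-exts t)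
  where ext-exts : renV (ext ρ) ∘ exts σ ≗ exts τ
        ext-exts zero    = refl
        ext-exts (suc n) = trans (renV-ext-suc ρ (σ n)) (cong (renV suc) (e n))
renV-sub e (app t s)   = cong₂ app (renV-sub e t) (renV-sub e s)
renV-sub {ρ} {σ} e (catch t) =
  cong catch (renV-sub (λ n → trans (renV-renK ρ suc (σ n)) (cong (renK suc) (e n))) t)
renV-sub e (throw α t) = cong (throw α) (renV-sub e t)

renK-sub : ∀ {ρ σ τ} → renK ρ ∘ σ ≗ τ →
           ∀ t → renK ρ (sub σ t) ≡ sub τ (renK ρ t)
renK-sub e (var x)     = e x
renK-sub e unit        = refl
renK-sub e nil         = refl
renK-sub e cons        = refl
renK-sub e lrec        = refl
renK-sub {ρ} {σ} {τ} e (lam t) = cong lam (renK-sub renK-exts t)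
  where renK-exts : renK ρ ∘ exts σ ≗ exts τ
        renK-exts zero    = refl
        renK-exts (suc n) = trans (sym (renV-renK suc ρ (σ n))) (cong (renV suc) (e n))
renK-sub e (app t s)   = cong₂ app (renK-sub e t) (renK-sub e s)
renK-sub {ρ} {σ} e (catch t) =
  cong catch (renK-sub (λ n → trans (renK-ext-suc ρ (σ n)) (cong (renK suc) (e n))) t)
renK-sub e (throw α t) = cong (throw _) (renK-sub e t)

sub-exts-suc : ∀ τ t → sub (exts τ) (renV suc t) ≡ renV suc (sub τ t)
sub-exts-suc τ t = trans (sub-renV (λ _ → refl) t) (sym (renV-sub (λ _ → refl) t))

sub-renK-suc : ∀ τ t → sub (renK suc ∘ τ) (renK suc t) ≡ renK suc (sub τ t)
sub-renK-suc τ t = sym (renK-sub (λ _ → refl) t)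

sub-sub : ∀ {τ σ ζ} → sub τ ∘ σ ≗ ζ → sub τ ∘ sub σ ≗ sub ζ
sub-sub e (var x)     = e x
sub-sub e unit        = refl
sub-sub e nil         = refl
sub-sub e cons        = refl
sub-sub e lrec        = refl
sub-sub {τ} {σ} {ζ} e (lam t) = cong lam (sub-sub exts-exts t)
  where exts-exts : sub (exts τ) ∘ exts σ ≗ exts ζ
        exts-exts zero    = refl
        exts-exts (suc n) = trans (sub-exts-suc τ (σ n)) (cong (renV suc) (e n))
sub-sub e (app t s)   = cong₂ app (sub-sub e t) (sub-sub e s)
sub-sub {τ} {σ} e (catch t) =
  cong catch (sub-sub (λ n → trans (sub-renK-suc τ (σ n)) (cong (renK suc) (e n))) t)
sub-sub e (throw α t) = cong (throw α) (sub-sub e t)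

sub-id : ∀ {σ} → σ ≗ var → sub σ ≗ id
sub-id e (var x)     = e x
sub-id e unit        = refl
sub-id e nil         = refl
sub-id e cons        = refl
sub-id e lrec        = refl
sub-id e (lam t)     =
  cong lam (sub-id (λ { zero → refl ; (suc n) → cong (renV suc) (e n) }) t)
sub-id e (app t s)   = cong₂ app (sub-id e t) (sub-id e s)
sub-id e (catch t)   = cong catch (sub-id (cong (renK suc) ∘ e) t)
sub-id e (throw α t) = cong (throw α) (sub-id e t)

renV-[] : ∀ ρ r v → renV ρ (r [ v ]) ≡ renV (ext ρ) r [ renV ρ v ]
renV-[] ρ r v = trans (renV-sub (λ _ → refl) r)
                      (sym (sub-renV (λ { zero → refl ; (suc n) → refl }) r))

renK-[] : ∀ ρ r v → renK ρ (r [ v ]) ≡ renK ρ r [ renK ρ v ]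
renK-[] ρ r v = renK-sub (λ { zero → refl ; (suc n) → refl }) r

sub-[] : ∀ τ r v → sub τ (r [ v ]) ≡ sub (exts τ) r [ sub τ v ]
sub-[] τ r v = trans (sub-sub (λ _ → refl) r) (sym (sub-sub single-exts r))
  where single-exts : sub (single (sub τ v)) ∘ exts τ ≗ sub τ ∘ single v
        single-exts zero    = refl
        single-exts (suc n) =
          trans (sub-renV (λ _ → refl) (τ n)) (sub-id (λ _ → refl) (τ n))

Value-renV : ∀ ρ {t} → Value t → Value (renV ρ t)
Value-renV ρ (v-var x)     = v-var _
Value-renV ρ v-unit        = v-unit
Value-renV ρ v-nil         = v-nil
Value-renV ρ v-cons0       = v-cons0
Value-renV ρ (v-cons1 v)   = v-cons1 (Value-renV ρ v)
Value-renV ρ (v-cons2 v w) = v-cons2 (Value-renV ρ v) (Value-renV ρ w)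
Value-renV ρ v-lrec0       = v-lrec0
Value-renV ρ (v-lrec1 v)   = v-lrec1 (Value-renV ρ v)
Value-renV ρ (v-lrec2 v w) = v-lrec2 (Value-renV ρ v) (Value-renV ρ w)
Value-renV ρ (v-lam r)     = v-lam _

Value-renK : ∀ ρ {t} → Value t → Value (renK ρ t)
Value-renK ρ (v-var x)     = v-var x
Value-renK ρ v-unit        = v-unit
Value-renK ρ v-nil         = v-nil
Value-renK ρ v-cons0       = v-cons0
Value-renK ρ (v-cons1 v)   = v-cons1 (Value-renK ρ v)
Value-renK ρ (v-cons2 v w) = v-cons2 (Value-renK ρ v) (Value-renK ρ w)
Value-renK ρ v-lrec0       = v-lrec0
Value-renK ρ (v-lrec1 v)   = v-lrec1 (Value-renK ρ v)
Value-renK ρ (v-lrec2 v w) = v-lrec2 (Value-renK ρ v) (Value-renK ρ w)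
Value-renK ρ (v-lam r)     = v-lam _

ValueSub : (ℕ → Tm) → Set
ValueSub σ = ∀ x → Value (σ x)

Value-sub : ∀ {σ} → ValueSub σ → ∀ {t} → Value t → Value (sub σ t)
Value-sub σ-val (v-var x)     = σ-val x
Value-sub σ-val v-unit        = v-unit
Value-sub σ-val v-nil         = v-nil
Value-sub σ-val v-cons0       = v-cons0
Value-sub σ-val (v-cons1 v)   = v-cons1 (Value-sub σ-val v)
Value-sub σ-val (v-cons2 v w) = v-cons2 (Value-sub σ-val v) (Value-sub σ-val w)
Value-sub σ-val v-lrec0       = v-lrec0
Value-sub σ-val (v-lrec1 v)   = v-lrec1 (Value-sub σ-val v)
Value-sub σ-val (v-lrec2 v w) = v-lrec2 (Value-sub σ-val v) (Value-sub σ-val w)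
Value-sub σ-val (v-lam r)     = v-lam _

ValueSub-exts : ∀ {σ} → ValueSub σ → ValueSub (exts σ)
ValueSub-exts σ-val zero    = v-var zero
ValueSub-exts σ-val (suc n) = Value-renV suc (σ-val n)

ValueSub-weaken : ∀ {σ} → ValueSub σ → ValueSub (renK suc ∘ σ)
ValueSub-weaken σ-val n = Value-renK suc (σ-val n)

ValueSub-single : ∀ {v} → Value v → ValueSub (single v)
ValueSub-single v zero    = v
ValueSub-single v (suc n) = v-var n

Value-⟶ : ∀ {t t'} → Value t → t ⟶ t' → Value t'
Value-⟶ (v-cons1 v)   (ξ-appR s)          = v-cons1 (Value-⟶ v s)
Value-⟶ (v-cons1 ())  (throw-appR _)
Value-⟶ (v-cons2 v w) (ξ-appL (ξ-appR s)) = v-cons2 (Value-⟶ v s) w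
Value-⟶ (v-cons2 () w) (ξ-appL (throw-appR _))
Value-⟶ (v-cons2 v w) (ξ-appR s)          = v-cons2 v (Value-⟶ w s)
Value-⟶ (v-cons2 v ()) (throw-appR _)
Value-⟶ (v-lrec1 v)   (ξ-appR s)          = v-lrec1 (Value-⟶ v s)
Value-⟶ (v-lrec1 ())  (throw-appR _)
Value-⟶ (v-lrec2 v w) (ξ-appL (ξ-appR s)) = v-lrec2 (Value-⟶ v s) w
Value-⟶ (v-lrec2 () w) (ξ-appL (throw-appR _))
Value-⟶ (v-lrec2 v w) (ξ-appR s)          = v-lrec2 v (Value-⟶ w s)
Value-⟶ (v-lrec2 v ()) (throw-appR _)
Value-⟶ (v-lam r)     (ξ-lam s)           = v-lam _

⟶-renV : ∀ ρ {t t'} → t ⟶ t' → renV ρ t ⟶ renV ρ t'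
⟶-renV ρ (β-lam {t} {v} x) rewrite renV-[] ρ t v = β-lam (Value-renV ρ x)
⟶-renV ρ throw-appL            = throw-appL
⟶-renV ρ (throw-appR x)        = throw-appR (Value-renV ρ x)
⟶-renV ρ throw-throw           = throw-throw
⟶-renV ρ catch-throw           = catch-throw
⟶-renV ρ (catch-other {v = v} x) rewrite renV-renK ρ suc v = catch-other (Value-renV ρ x)
⟶-renV ρ (catch-val {v} x)     rewrite renV-renK ρ suc v = catch-val (Value-renV ρ x)
⟶-renV ρ (lrec-nil a b)        = lrec-nil (Value-renV ρ a) (Value-renV ρ b)
⟶-renV ρ (lrec-cons a b c d)   =
  lrec-cons (Value-renV ρ a) (Value-renV ρ b) (Value-renV ρ c) (Value-renV ρ d)
⟶-renV ρ (ξ-lam s)             = ξ-lam (⟶-renV (ext ρ) s)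
⟶-renV ρ (ξ-appL s)            = ξ-appL (⟶-renV ρ s)
⟶-renV ρ (ξ-appR s)            = ξ-appR (⟶-renV ρ s)
⟶-renV ρ (ξ-catch s)           = ξ-catch (⟶-renV ρ s)
⟶-renV ρ (ξ-throw s)           = ξ-throw (⟶-renV ρ s)

⟶-renK : ∀ ρ {t t'} → t ⟶ t' → renK ρ t ⟶ renK ρ t'
⟶-renK ρ (β-lam {t} {v} x) rewrite renK-[] ρ t v = β-lam (Value-renK ρ x)
⟶-renK ρ throw-appL            = throw-appL
⟶-renK ρ (throw-appR x)        = throw-appR (Value-renK ρ x)
⟶-renK ρ throw-throw           = throw-throw
⟶-renK ρ catch-throw           = catch-throw
⟶-renK ρ (catch-other {v = v} x) rewrite renK-ext-suc ρ v = catch-other (Value-renK ρ x)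
⟶-renK ρ (catch-val {v} x)     rewrite renK-ext-suc ρ v = catch-val (Value-renK ρ x)
⟶-renK ρ (lrec-nil a b)        = lrec-nil (Value-renK ρ a) (Value-renK ρ b)
⟶-renK ρ (lrec-cons a b c d)   =
  lrec-cons (Value-renK ρ a) (Value-renK ρ b) (Value-renK ρ c) (Value-renK ρ d)
⟶-renK ρ (ξ-lam s)             = ξ-lam (⟶-renK ρ s)
⟶-renK ρ (ξ-appL s)            = ξ-appL (⟶-renK ρ s)
⟶-renK ρ (ξ-appR s)            = ξ-appR (⟶-renK ρ s)
⟶-renK ρ (ξ-catch s)           = ξ-catch (⟶-renK (ext ρ) s)
⟶-renK ρ (ξ-throw s)           = ξ-throw (⟶-renK ρ s)

⟶-sub : ∀ {σ} → ValueSub σ → ∀ {t t'} → t ⟶ t' → sub σ t ⟶ sub σ t'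
⟶-sub {σ} σ-val (β-lam {t} {v} x) rewrite sub-[] σ t v = β-lam (Value-sub σ-val x)
⟶-sub σ-val throw-appL            = throw-appL
⟶-sub σ-val (throw-appR x)        = throw-appR (Value-sub σ-val x)
⟶-sub σ-val throw-throw           = throw-throw
⟶-sub σ-val catch-throw           = catch-throw
⟶-sub {σ} σ-val (catch-other {v = v} x) rewrite sub-renK-suc σ v =
  catch-other (Value-sub σ-val x)
⟶-sub {σ} σ-val (catch-val {v} x) rewrite sub-renK-suc σ v = catch-val (Value-sub σ-val x)
⟶-sub σ-val (lrec-nil a b)        = lrec-nil (Value-sub σ-val a) (Value-sub σ-val b)
⟶-sub σ-val (lrec-cons a b c d)   =
  lrec-cons (Value-sub σ-val a) (Value-sub σ-val b) (Value-sub σ-val c) (Value-sub σ-val d)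
⟶-sub σ-val (ξ-lam s)             = ξ-lam (⟶-sub (ValueSub-exts σ-val) s)
⟶-sub σ-val (ξ-appL s)            = ξ-appL (⟶-sub σ-val s)
⟶-sub σ-val (ξ-appR s)            = ξ-appR (⟶-sub σ-val s)
⟶-sub σ-val (ξ-catch s)           = ξ-catch (⟶-sub (ValueSub-weaken σ-val) s)
⟶-sub σ-val (ξ-throw s)           = ξ-throw (⟶-sub σ-val s)

⟶*-renV : ∀ ρ {t t'} → t ⟶* t' → renV ρ t ⟶* renV ρ t'
⟶*-renV ρ = gmap (renV ρ) (⟶-renV ρ)

⟶*-renK : ∀ ρ {t t'} → t ⟶* t' → renK ρ t ⟶* renK ρ t'
⟶*-renK ρ = gmap (renK ρ) (⟶-renK ρ)

⟶*-sub : ∀ {σ} → ValueSub σ → ∀ {t t'} → t ⟶* t' → sub σ t ⟶* sub σ t'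
⟶*-sub σ-val = gmap (sub _) (⟶-sub σ-val)

⟶*-lam : ∀ {t t'} → t ⟶* t' → lam t ⟶* lam t'
⟶*-lam = gmap lam ξ-lam

⟶*-app : ∀ {t t' s s'} → t ⟶* t' → s ⟶* s' → app t s ⟶* app t' s'
⟶*-app p q = gmap (λ t → app t _) ξ-appL p ◅◅ gmap (app _) ξ-appR q

⟶*-catch : ∀ {t t'} → t ⟶* t' → catch t ⟶* catch t'
⟶*-catch = gmap catch ξ-catch

⟶*-throw : ∀ {α t t'} → t ⟶* t' → throw α t ⟶* throw α t'
⟶*-throw = gmap (throw _) ξ-throw

sub-⟶* : ∀ {σ τ} → (∀ x → σ x ⟶* τ x) → ∀ t → sub σ t ⟶* sub τ t
sub-⟶* p (var x)     = p x
sub-⟶* p unit        = ε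
sub-⟶* p nil         = ε
sub-⟶* p cons        = ε
sub-⟶* p lrec        = ε
sub-⟶* p (lam t)     =
  ⟶*-lam (sub-⟶* (λ { zero → ε ; (suc n) → ⟶*-renV suc (p n) }) t)
sub-⟶* p (app t s)   = ⟶*-app (sub-⟶* p t) (sub-⟶* p s)
sub-⟶* p (catch t)   = ⟶*-catch (sub-⟶* (⟶*-renK suc ∘ p) t)
sub-⟶* p (throw α t) = ⟶*-throw (sub-⟶* p t)

mentions : ℕ → Tm → Bool
mentions k (var x)     = false
mentions k unit        = false
mentions k nil         = false
mentions k cons        = false
mentions k lrec        = false
mentions k (lam t)     = mentions k t
mentions k (app t s)   = mentions k t ∨ mentions k s
mentions k (catch t)   = mentions (suc k) t
mentions k (throw α t) = (α ≡ᵇ k) ∨ mentions k t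

infix 4 _#_
_#_ : ℕ → Tm → Set
k # t = mentions k t ≡ false

mentions-renV : ∀ k ρ t → mentions k (renV ρ t) ≡ mentions k t
mentions-renV k ρ (var x)     = refl
mentions-renV k ρ unit        = refl
mentions-renV k ρ nil         = refl
mentions-renV k ρ cons        = refl
mentions-renV k ρ lrec        = refl
mentions-renV k ρ (lam t)     = mentions-renV k (ext ρ) t
mentions-renV k ρ (app t s)   = cong₂ _∨_ (mentions-renV k ρ t) (mentions-renV k ρ s)
mentions-renV k ρ (catch t)   = mentions-renV (suc k) ρ t
mentions-renV k ρ (throw α t) = cong ((α ≡ᵇ k) ∨_) (mentions-renV k ρ t)

mentions-renK : ∀ {k j ρ} → (∀ m → (ρ m ≡ᵇ k) ≡ (m ≡ᵇ j)) →
                ∀ t → mentions k (renK ρ t) ≡ mentions j t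
mentions-renK e (var x)     = refl
mentions-renK e unit        = refl
mentions-renK e nil         = refl
mentions-renK e cons        = refl
mentions-renK e lrec        = refl
mentions-renK e (lam t)     = mentions-renK e t
mentions-renK e (app t s)   = cong₂ _∨_ (mentions-renK e t) (mentions-renK e s)
mentions-renK e (catch t)   = mentions-renK (λ { zero → refl ; (suc m) → e m }) t
mentions-renK e (throw α t) = cong₂ _∨_ (e α) (mentions-renK e t)

mentions-weaken : ∀ k t → mentions (suc k) (renK suc t) ≡ mentions k t
mentions-weaken k = mentions-renK (λ _ → refl)

#-renK : ∀ {k ρ} → (∀ m → (ρ m ≡ᵇ k) ≡ false) → ∀ t → k # renK ρ t
#-renK e (var x)     = refl
#-renK e unit        = refl
#-renK e nil         = refl
#-renK e cons        = refl
#-renK e lrec        = refl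
#-renK e (lam t)     = #-renK e t
#-renK e (app t s)   = cong₂ _∨_ (#-renK e t) (#-renK e s)
#-renK e (catch t)   = #-renK (λ { zero → refl ; (suc m) → e m }) t
#-renK e (throw α t) = cong₂ _∨_ (e α) (#-renK e t)

#-weaken : ∀ t → zero # renK suc t
#-weaken = #-renK (λ _ → refl)

#-renK-ext : ∀ ρ t → zero # t → zero # renK (ext ρ) t
#-renK-ext ρ t o = trans (mentions-renK (λ { zero → refl ; (suc m) → refl }) t) o

#-sub : ∀ {k σ} → (∀ x → k # σ x) → ∀ t → k # t → k # sub σ t
#-sub e (var x)     _ = e x
#-sub e unit        _ = refl
#-sub e nil         _ = refl
#-sub e cons        _ = refl
#-sub e lrec        _ = refl
#-sub {k} {σ} e (lam t) o = #-sub e-exts t o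
  where e-exts : ∀ x → k # exts σ x
        e-exts zero    = refl
        e-exts (suc n) = trans (mentions-renV k suc (σ n)) (e n)
#-sub e (app t s) o =
  cong₂ _∨_ (#-sub e t (∨-conicalˡ _ _ o)) (#-sub e s (∨-conicalʳ _ _ o))
#-sub {k} {σ} e (catch t) o = #-sub (λ x → trans (mentions-weaken k (σ x)) (e x)) t o
#-sub e (throw α t) o = cong₂ _∨_ (∨-conicalˡ _ _ o) (#-sub e t (∨-conicalʳ _ _ o))

#-⟶ : ∀ {k t t'} → t ⟶ t' → k # t → k # t'
#-⟶ {k} (β-lam {t} {v} _) o =
  #-sub (λ { zero → ∨-conicalʳ (mentions k t) _ o ; (suc n) → refl })
        t (∨-conicalˡ _ _ o)
#-⟶ {k} (throw-appL {α} {t}) o = ∨-conicalˡ (mentions k (throw α t)) _ o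
#-⟶ {k} (throw-appR {v} _)  o = ∨-conicalʳ (mentions k v) _ o
#-⟶ {k} (throw-throw {β})   o = ∨-conicalʳ (β ≡ᵇ k) _ o
#-⟶ catch-throw o = o
#-⟶ {k} (catch-other {β} {v} _) o =
  cong₂ _∨_ (∨-conicalˡ _ _ o)
            (trans (sym (mentions-weaken k v)) (∨-conicalʳ (β ≡ᵇ k) _ o))
#-⟶ {k} (catch-val {v} _) o = trans (sym (mentions-weaken k v)) o
#-⟶ {k} (lrec-nil {vr} {vs} _ _) o =
  ∨-conicalˡ (mentions k vr) _ (∨-conicalˡ (mentions k vr ∨ mentions k vs) _ o)
#-⟶ {k} (lrec-cons {vr} {vs} {vh} {vt} _ _ _ _) o =
  cong₂ _∨_ (cong₂ _∨_ (cong₂ _∨_ vs# vh#) vt#)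
            (cong₂ _∨_ (cong₂ _∨_ vr# vs#) vt#)
  where
  lrec# = ∨-conicalˡ (mentions k vr ∨ mentions k vs) _ o
  cons# = ∨-conicalʳ (mentions k vr ∨ mentions k vs) _ o
  vr#   = ∨-conicalˡ (mentions k vr) _ lrec#
  vs#   = ∨-conicalʳ (mentions k vr) _ lrec#
  vh#   = ∨-conicalˡ (mentions k vh) _ cons#
  vt#   = ∨-conicalʳ (mentions k vh) _ cons#
#-⟶ (ξ-lam s) o = #-⟶ s o
#-⟶ {k} (ξ-appL {t} s) o =
  cong₂ _∨_ (#-⟶ s (∨-conicalˡ _ _ o)) (∨-conicalʳ (mentions k t) _ o)
#-⟶ {k} (ξ-appR {t} s) o =
  cong₂ _∨_ (∨-conicalˡ _ _ o) (#-⟶ s (∨-conicalʳ (mentions k t) _ o))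
#-⟶ (ξ-catch s) o = #-⟶ s o
#-⟶ {k} (ξ-throw {α} s) o =
  cong₂ _∨_ (∨-conicalˡ _ _ o) (#-⟶ s (∨-conicalʳ (α ≡ᵇ k) _ o))

renK-cong-# : ∀ {k ρ τ} → (∀ m → (m ≡ᵇ k) ≡ false → ρ m ≡ τ m) →
              ∀ t → k # t → renK ρ t ≡ renK τ t
renK-cong-# e (var x)     _ = refl
renK-cong-# e unit        _ = refl
renK-cong-# e nil         _ = refl
renK-cong-# e cons        _ = refl
renK-cong-# e lrec        _ = refl
renK-cong-# e (lam t)     o = cong lam (renK-cong-# e t o)
renK-cong-# {k} e (app t s) o =
  cong₂ app (renK-cong-# e t (∨-conicalˡ _ _ o))
            (renK-cong-# e s (∨-conicalʳ (mentions k t) _ o))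
renK-cong-# e (catch t)   o =
  cong catch (renK-cong-# (λ { zero _ → refl ; (suc m) p → cong suc (e m p) }) t o)
renK-cong-# {k} e (throw α t) o =
  cong₂ throw (e α (∨-conicalˡ _ _ o)) (renK-cong-# e t (∨-conicalʳ (α ≡ᵇ k) _ o))

-- Only meaningful on terms t with zero # t, since pred identifies the indices 0 and 1.
strengthen : Tm → Tm
strengthen = renK pred

strengthen-weaken : ∀ t → strengthen (renK suc t) ≡ t
strengthen-weaken = renK-inverse (λ _ → refl)

renK-strengthen : ∀ {ρ τ} → (∀ m → ρ m ≡ τ (suc m)) →
                  ∀ t → zero # t → renK ρ (strengthen t) ≡ renK τ t
renK-strengthen e t o =
  trans (renK-renK (λ _ → refl) t) (renK-cong-# (λ { zero () ; (suc m) _ → e m }) t o)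

weaken-strengthen : ∀ t → zero # t → renK suc (strengthen t) ≡ t
weaken-strengthen t o = trans (renK-strengthen (λ _ → refl) t o) (renK-id (λ _ → refl) t)

strengthen-renK : ∀ ρ t → zero # t → strengthen (renK (ext ρ) t) ≡ renK ρ (strengthen t)
strengthen-renK ρ t o =
  trans (renK-renK (λ _ → refl) t) (sym (renK-strengthen (λ _ → refl) t o))

strengthen-sub : ∀ τ t → zero # t →
                 sub τ (strengthen t) ≡ strengthen (sub (renK suc ∘ τ) t)
strengthen-sub τ t o =
  trans (sym (strengthen-weaken (sub τ (strengthen t))))
        (cong strengthen (trans (renK-sub (λ _ → refl) (strengthen t))
                                (cong (sub (renK suc ∘ τ)) (weaken-strengthen t o))))

-- The root rules of ⟶ as a development contracts them: the side condition α ∉ FCV(v) is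
-- expressed by the decidable zero # v, and the contractum is the strengthened body.
infix 4 _↦_
data _↦_ : Tm → Tm → Set where
  ↦-β           : ∀ {t v} → Value v → app (lam t) v ↦ t [ v ]
  ↦-throwL      : ∀ {α t s} → app (throw α t) s ↦ throw α t
  ↦-throwR      : ∀ {v α t} → Value v → app v (throw α t) ↦ throw α t
  ↦-throw       : ∀ {β α t} → throw β (throw α t) ↦ throw α t
  ↦-catch-throw : ∀ {t} → catch (throw zero t) ↦ catch t
  ↦-catch-other : ∀ {β v} → Value v → zero # v →
                  catch (throw (suc β) v) ↦ throw β (strengthen v)
  ↦-catch-val   : ∀ {v} → Value v → zero # v → catch v ↦ strengthen v
  ↦-lrec-nil    : ∀ {vr vs} → Value vr → Value vs → app (app (app lrec vr) vs) nil ↦ vr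
  ↦-lrec-cons   : ∀ {vr vs vh vt} → Value vr → Value vs → Value vh → Value vt →
                  app (app (app lrec vr) vs) (vh ∷ₜ vt)
                    ↦ app (app (app vs vh) vt) (app (app (app lrec vr) vs) vt)

↦⇒⟶ : ∀ {t u} → t ↦ u → t ⟶ u
↦⇒⟶ (↦-β v)                = β-lam v
↦⇒⟶ ↦-throwL               = throw-appL
↦⇒⟶ (↦-throwR v)           = throw-appR v
↦⇒⟶ ↦-throw                = throw-throw
↦⇒⟶ ↦-catch-throw          = catch-throw
↦⇒⟶ (↦-catch-other {β} {v} vv o) =
  subst (λ w → catch (throw (suc β) w) ⟶ throw β (strengthen v))
        (weaken-strengthen v o) (catch-other (Value-renK pred vv))
↦⇒⟶ (↦-catch-val {v} vv o) =
  subst (λ w → catch w ⟶ strengthen v) (weaken-strengthen v o) (catch-val (Value-renK pred vv))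
↦⇒⟶ (↦-lrec-nil a b)       = lrec-nil a b
↦⇒⟶ (↦-lrec-cons a b c d)  = lrec-cons a b c d

↦-renV : ∀ ρ {t u} → t ↦ u → renV ρ t ↦ renV ρ u
↦-renV ρ (↦-β {t} {v} vv) rewrite renV-[] ρ t v = ↦-β (Value-renV ρ vv)
↦-renV ρ ↦-throwL         = ↦-throwL
↦-renV ρ (↦-throwR v)     = ↦-throwR (Value-renV ρ v)
↦-renV ρ ↦-throw          = ↦-throw
↦-renV ρ ↦-catch-throw    = ↦-catch-throw
↦-renV ρ (↦-catch-other {v = v} vv o) rewrite renV-renK ρ pred v =
  ↦-catch-other (Value-renV ρ vv) (trans (mentions-renV zero ρ v) o)
↦-renV ρ (↦-catch-val {v} vv o) rewrite renV-renK ρ pred v =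
  ↦-catch-val (Value-renV ρ vv) (trans (mentions-renV zero ρ v) o)
↦-renV ρ (↦-lrec-nil a b) = ↦-lrec-nil (Value-renV ρ a) (Value-renV ρ b)
↦-renV ρ (↦-lrec-cons a b c d) =
  ↦-lrec-cons (Value-renV ρ a) (Value-renV ρ b) (Value-renV ρ c) (Value-renV ρ d)

↦-renK : ∀ ρ {t u} → t ↦ u → renK ρ t ↦ renK ρ u
↦-renK ρ (↦-β {t} {v} vv) rewrite renK-[] ρ t v = ↦-β (Value-renK ρ vv)
↦-renK ρ ↦-throwL         = ↦-throwL
↦-renK ρ (↦-throwR v)     = ↦-throwR (Value-renK ρ v)
↦-renK ρ ↦-throw          = ↦-throw
↦-renK ρ ↦-catch-throw    = ↦-catch-throw
↦-renK ρ (↦-catch-other {v = v} vv o) rewrite sym (strengthen-renK ρ v o) =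
  ↦-catch-other (Value-renK (ext ρ) vv) (#-renK-ext ρ v o)
↦-renK ρ (↦-catch-val {v} vv o) rewrite sym (strengthen-renK ρ v o) =
  ↦-catch-val (Value-renK (ext ρ) vv) (#-renK-ext ρ v o)
↦-renK ρ (↦-lrec-nil a b) = ↦-lrec-nil (Value-renK ρ a) (Value-renK ρ b)
↦-renK ρ (↦-lrec-cons a b c d) =
  ↦-lrec-cons (Value-renK ρ a) (Value-renK ρ b) (Value-renK ρ c) (Value-renK ρ d)

↦-sub : ∀ {σ} → ValueSub σ → ∀ {t u} → t ↦ u → sub σ t ↦ sub σ u
↦-sub {σ} σ-val (↦-β {t} {v} vv) rewrite sub-[] σ t v = ↦-β (Value-sub σ-val vv)
↦-sub σ-val ↦-throwL         = ↦-throwL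
↦-sub σ-val (↦-throwR v)     = ↦-throwR (Value-sub σ-val v)
↦-sub σ-val ↦-throw          = ↦-throw
↦-sub σ-val ↦-catch-throw    = ↦-catch-throw
↦-sub {σ} σ-val (↦-catch-other {v = v} vv o) rewrite strengthen-sub σ v o =
  ↦-catch-other (Value-sub (ValueSub-weaken σ-val) vv) (#-sub (#-weaken ∘ σ) v o)
↦-sub {σ} σ-val (↦-catch-val {v} vv o) rewrite strengthen-sub σ v o =
  ↦-catch-val (Value-sub (ValueSub-weaken σ-val) vv) (#-sub (#-weaken ∘ σ) v o)
↦-sub σ-val (↦-lrec-nil a b) = ↦-lrec-nil (Value-sub σ-val a) (Value-sub σ-val b)
↦-sub σ-val (↦-lrec-cons a b c d) =
  ↦-lrec-cons (Value-sub σ-val a) (Value-sub σ-val b) (Value-sub σ-val c) (Value-sub σ-val d)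

value? : (t : Tm) → Maybe (Value t)
value? (var x)               = just (v-var x)
value? unit                  = just v-unit
value? nil                   = just v-nil
value? cons                  = just v-cons0
value? lrec                  = just v-lrec0
value? (lam r)               = just (v-lam r)
value? (app cons v)          = map v-cons1 (value? v)
value? (app lrec v)          = map v-lrec1 (value? v)
value? (app (app cons v) w)  = zipWith v-cons2 (value? v) (value? w)
value? (app (app lrec v) w)  = zipWith v-lrec2 (value? v) (value? w)
value? _                     = nothing

value?-complete : ∀ {t} (v : Value t) → value? t ≡ just v
value?-complete (v-var x)     = refl
value?-complete v-unit        = refl
value?-complete v-nil         = refl
value?-complete v-cons0       = refl
value?-complete (v-cons1 v)   rewrite value?-complete v = refl
value?-complete (v-cons2 v w) rewrite value?-complete v | value?-complete w = refl
value?-complete v-lrec0       = refl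
value?-complete (v-lrec1 v)   rewrite value?-complete v = refl
value?-complete (v-lrec2 v w) rewrite value?-complete v | value?-complete w = refl
value?-complete (v-lam r)     = refl

freshValue? : (t : Tm) → Maybe (Value t × zero # t)
freshValue? t with value? t
... | nothing = nothing
... | just v with mentions zero t
...   | true  = nothing
...   | false = just (v , refl)

freshValue?-complete : ∀ {t} → Value t → zero # t →
                       ∃ λ p → freshValue? t ≡ just p
freshValue?-complete {t} v o with value? t | value?-complete v
... | just _ | refl with mentions zero t
...   | false = _ , refl

throwL? : ∀ t s → Maybe (∃ (app t s ↦_))
throwL? (throw α t) s = just (_ , ↦-throwL)
throwL? _           _ = nothing

throwR? : ∀ {v} → Value v → ∀ s → Maybe (∃ (app v s ↦_))
throwR? v (throw α t) = just (_ , ↦-throwR v)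
throwR? _ _           = nothing

valueRedex? : ∀ {v w} → Value v → Value w → Maybe (∃ (app v w ↦_))
valueRedex? (v-lam r)       w               = just (_ , ↦-β w)
valueRedex? (v-lrec2 vr vs) v-nil           = just (_ , ↦-lrec-nil vr vs)
valueRedex? (v-lrec2 vr vs) (v-cons2 vh vt) = just (_ , ↦-lrec-cons vr vs vh vt)
valueRedex? _               _               = nothing

appRedex? : ∀ t s → Maybe (∃ (app t s ↦_))
appRedex? t s with value? t
... | nothing = throwL? t s
... | just vt with value? s
...   | nothing = throwR? vt s
...   | just vs = valueRedex? vt vs

catchRedex? : ∀ t → Maybe (∃ (catch t ↦_))
catchRedex? t with freshValue? t
... | just (v , o) = just (_ , ↦-catch-val v o)
catchRedex? (throw zero t)    | nothing = just (_ , ↦-catch-throw)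
catchRedex? (throw (suc β) w) | nothing =
  map (λ (v , o) → _ , ↦-catch-other v o) (freshValue? w)
catchRedex? _                 | nothing = nothing

redex? : (t : Tm) → Maybe (∃ (t ↦_))
redex? (app t s)             = appRedex? t s
redex? (throw β (throw α t)) = just (_ , ↦-throw)
redex? (catch t)             = catchRedex? t
redex? _                     = nothing

redex?-complete : ∀ {t u} → t ↦ u → ∃ λ r → redex? t ≡ just (u , r)
redex?-complete (↦-β vv) rewrite value?-complete vv = _ , refl
redex?-complete ↦-throwL = _ , refl
redex?-complete (↦-throwR vv) rewrite value?-complete vv = _ , refl
redex?-complete ↦-throw = _ , refl
redex?-complete ↦-catch-throw = _ , refl
redex?-complete (↦-catch-other {v = w} vw o) with freshValue? w | freshValue?-complete vw o
... | just _ | _ , refl = _ , refl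
redex?-complete (↦-catch-val {v} vv o) with freshValue? v | freshValue?-complete vv o
... | just _ | _ , refl = _ , refl
redex?-complete (↦-lrec-nil a b) rewrite value?-complete a | value?-complete b = _ , refl
redex?-complete (↦-lrec-cons a b c d)
  rewrite value?-complete a | value?-complete b | value?-complete c | value?-complete d = _ , refl

contract : Tm → Tm
contract t with redex? t
... | just (u , _) = u
... | nothing      = t

contract-↦ : ∀ {t u} → t ↦ u → contract t ≡ u
contract-↦ {t} r with redex? t | redex?-complete r
... | just _ | _ , refl = refl

⟶*-contract : ∀ t → t ⟶* contract t
⟶*-contract t with redex? t
... | just (_ , r) = ↦⇒⟶ r ◅ ε
... | nothing      = ε

Value⇒¬↦ : ∀ {t u} → Value t → t ↦ u → ⊥
Value⇒¬↦ (v-cons1 ())   (↦-throwR _)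
Value⇒¬↦ (v-cons2 _ ()) (↦-throwR _)
Value⇒¬↦ (v-lrec1 ())   (↦-throwR _)
Value⇒¬↦ (v-lrec2 _ ()) (↦-throwR _)

contract-Value : ∀ {t} → Value t → contract t ≡ t
contract-Value {t} v with redex? t
... | just (_ , r) = ⊥-elim (Value⇒¬↦ v r)
... | nothing      = refl

contract-hom : ∀ {h : Tm → Tm} →
               (∀ {t u} → t ↦ u → h t ↦ h u) →
               (∀ {t u} → h t ↦ u → ∃ (t ↦_)) →
               ∀ t → h (contract t) ≡ contract (h t)
contract-hom {h} preserve reflect t with redex? t in eq
... | just (u , r) = sym (contract-↦ (preserve r))
... | nothing with redex? (h t)
...   | nothing       = refl
...   | just (_ , r') with redex?-complete (proj₂ (reflect r'))
...     | _ , eq' with () ← trans (sym eq) eq'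

renV-contract : ∀ π {ρ} → π ∘ ρ ≗ id →
                ∀ t → renV ρ (contract t) ≡ contract (renV ρ t)
renV-contract π {ρ} inv =
  contract-hom (↦-renV ρ) (λ r → _ , subst (_↦ _) (renV-inverse inv _) (↦-renV π r))

renK-contract : ∀ π {ρ} → π ∘ ρ ≗ id →
                ∀ t → renK ρ (contract t) ≡ contract (renK ρ t)
renK-contract π {ρ} inv =
  contract-hom (↦-renK ρ) (λ r → _ , subst (_↦ _) (renK-inverse inv _) (↦-renK π r))

sub-contract : ∀ {σ} → ValueSub σ → ∀ t → sub σ (contract t) ⟶* contract (sub σ t)
sub-contract σ-val t with redex? t
... | just (u , r) = reflexive _⟶_ (sym (contract-↦ (↦-sub σ-val r)))
... | nothing      = ⟶*-contract _

⟶*-contract-↦ : ∀ {t u u'} → u ⟶* u' → t ↦ u' → u ⟶* contract t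
⟶*-contract-↦ p r = p ◅◅ reflexive _⟶_ (sym (contract-↦ r))

↦-appL-⟶ : ∀ {a a' b u} → app a b ↦ u → a ⟶ a' → u ⟶* contract (app a' b)
↦-appL-⟶ (↦-β v) (ξ-lam s) =
  ⟶*-contract-↦ (⟶-sub (ValueSub-single v) s ◅ ε) (↦-β v)
↦-appL-⟶ {b = b} ↦-throwL (ξ-throw s) =
  ⟶*-contract-↦ (ξ-throw s ◅ ε) (↦-throwL {s = b})
↦-appL-⟶ {b = b} ↦-throwL throw-throw =
  ⟶*-contract-↦ (throw-throw ◅ ε) (↦-throwL {s = b})
↦-appL-⟶ (↦-throwR v) s = ⟶*-contract-↦ ε (↦-throwR (Value-⟶ v s))
↦-appL-⟶ (↦-lrec-nil a b) (ξ-appL (ξ-appR s)) =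
  ⟶*-contract-↦ (s ◅ ε) (↦-lrec-nil (Value-⟶ a s) b)
↦-appL-⟶ (↦-lrec-nil () b) (ξ-appL (throw-appR _))
↦-appL-⟶ (↦-lrec-nil a b) (ξ-appR s) = ⟶*-contract-↦ ε (↦-lrec-nil a (Value-⟶ b s))
↦-appL-⟶ (↦-lrec-nil a ()) (throw-appR _)
↦-appL-⟶ (↦-lrec-cons a b c d) (ξ-appL (ξ-appR s)) =
  ⟶*-contract-↦ (ξ-appR (ξ-appL (ξ-appL (ξ-appR s))) ◅ ε)
                (↦-lrec-cons (Value-⟶ a s) b c d)
↦-appL-⟶ (↦-lrec-cons () b c d) (ξ-appL (throw-appR _))
↦-appL-⟶ (↦-lrec-cons a b c d) (ξ-appR s) =
  ⟶*-contract-↦ (ξ-appL (ξ-appL (ξ-appL s)) ◅ ξ-appR (ξ-appL (ξ-appR s)) ◅ ε)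
                (↦-lrec-cons a (Value-⟶ b s) c d)
↦-appL-⟶ (↦-lrec-cons a () c d) (throw-appR _)

↦-appR-⟶ : ∀ {a b b' u} → app a b ↦ u → b ⟶ b' → u ⟶* contract (app a b')
↦-appR-⟶ (↦-β {t} v) s =
  ⟶*-contract-↦ (sub-⟶* (λ { zero → s ◅ ε ; (suc n) → ε }) t)
                (↦-β (Value-⟶ v s))
↦-appR-⟶ {b' = b'} ↦-throwL s = ⟶*-contract-↦ ε (↦-throwL {s = b'})
↦-appR-⟶ (↦-throwR v) (ξ-throw s) = ⟶*-contract-↦ (ξ-throw s ◅ ε) (↦-throwR v)
↦-appR-⟶ (↦-throwR v) throw-throw = ⟶*-contract-↦ (throw-throw ◅ ε) (↦-throwR v)
↦-appR-⟶ (↦-lrec-cons a b c d) (ξ-appL (ξ-appR s)) =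
  ⟶*-contract-↦ (ξ-appL (ξ-appL (ξ-appR s)) ◅ ε) (↦-lrec-cons a b (Value-⟶ c s) d)
↦-appR-⟶ (↦-lrec-cons a b () d) (ξ-appL (throw-appR _))
↦-appR-⟶ (↦-lrec-cons a b c d) (ξ-appR s) =
  ⟶*-contract-↦ (ξ-appL (ξ-appR s) ◅ ξ-appR (ξ-appR s) ◅ ε)
                (↦-lrec-cons a b c (Value-⟶ d s))
↦-appR-⟶ (↦-lrec-cons a b c ()) (throw-appR _)

↦-throw-⟶ : ∀ {α a a' u} → throw α a ↦ u → a ⟶ a' → u ⟶* contract (throw α a')
↦-throw-⟶ {α} ↦-throw s@(ξ-throw _) = ⟶*-contract-↦ (s ◅ ε) (↦-throw {β = α})
↦-throw-⟶ {α} ↦-throw s@throw-throw = ⟶*-contract-↦ (s ◅ ε) (↦-throw {β = α})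

↦-catch-⟶ : ∀ {a a' u} → catch a ↦ u → a ⟶ a' → u ⟶* contract (catch a')
↦-catch-⟶ ↦-catch-throw (ξ-throw s) = ⟶*-contract-↦ (ξ-catch s ◅ ε) ↦-catch-throw
↦-catch-⟶ ↦-catch-throw throw-throw = ⟶*-contract _
↦-catch-⟶ (↦-catch-other v o) (ξ-throw s) =
  ⟶*-contract-↦ (ξ-throw (⟶-renK pred s) ◅ ε)
                (↦-catch-other (Value-⟶ v s) (#-⟶ s o))
↦-catch-⟶ (↦-catch-other () o) throw-throw
↦-catch-⟶ (↦-catch-val v o) s =
  ⟶*-contract-↦ (⟶-renK pred s ◅ ε) (↦-catch-val (Value-⟶ v s) (#-⟶ s o))

contract-⟶* : (C : Tm → Tm) → (∀ {a a'} → a ⟶ a' → C a ⟶ C a') →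
              (∀ {a a' u} → C a ↦ u → a ⟶ a' → u ⟶* contract (C a')) →
              ∀ {a a'} → a ⟶* a' → contract (C a) ⟶* contract (C a')
contract-⟶* C ξ lift = kleisliStar (contract ∘ C) step
  where
  step : ∀ {a a'} → a ⟶ a' → contract (C a) ⟶* contract (C a')
  step {a} {a'} s with redex? (C a)
  ... | just (_ , r) = lift r s
  ... | nothing      = ξ s ◅ ⟶*-contract (C a')

contract-app-⟶* : ∀ {a a' b b'} → a ⟶* a' → b ⟶* b' →
                  contract (app a b) ⟶* contract (app a' b')
contract-app-⟶* {a' = a'} {b} p q =
  contract-⟶* (λ a → app a b) ξ-appL ↦-appL-⟶ p
    ◅◅ contract-⟶* (app a') ξ-appR ↦-appR-⟶ q

contract-throw-⟶* : ∀ {α a a'} → a ⟶* a' →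
                    contract (throw α a) ⟶* contract (throw α a')
contract-throw-⟶* = contract-⟶* (throw _) ξ-throw ↦-throw-⟶

contract-catch-⟶* : ∀ {a a'} → a ⟶* a' → contract (catch a) ⟶* contract (catch a')
contract-catch-⟶* = contract-⟶* catch ξ-catch ↦-catch-⟶

contract-throw : ∀ α t → ∃₂ λ β u → contract (throw α t) ≡ throw β u
contract-throw α t with redex? (throw α t)
... | just (_ , ↦-throw) = _ , _ , refl
... | nothing            = _ , _ , refl

contract-throw-Value : ∀ {α v} → Value v → contract (throw α v) ≡ throw α v
contract-throw-Value {α} {v} vv with redex? (throw α v)
... | just (_ , ↦-throw) with () ← vv
... | nothing            = refl

contract-catch-throw : ∀ t → catch t ⟶* contract (catch (contract (throw zero t))) ×
                             contract (catch (contract (throw zero t))) ⟶* contract (catch t)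
contract-catch-throw t with redex? (throw zero t)
... | just (_ , ↦-throw) = ⟶*-contract _ , ε
... | nothing            = reflexive _⟶_ (sym e) , reflexive _⟶_ e ◅◅ ⟶*-contract _
  where e = contract-↦ (↦-catch-throw {t})

dev : Tm → Tm
dev (var x)     = var x
dev unit        = unit
dev nil         = nil
dev cons        = cons
dev lrec        = lrec
dev (lam t)     = lam (dev t)
dev (app t s)   = contract (app (dev t) (dev s))
dev (catch t)   = contract (catch (dev t))
dev (throw α t) = contract (throw α (dev t))

⟶*-dev-app : ∀ {a b} t s → a ⟶* dev t → b ⟶* dev s → app a b ⟶* dev (app t s)
⟶*-dev-app t s p q = ⟶*-app p q ◅◅ ⟶*-contract _

⟶*-dev : ∀ t → t ⟶* dev t
⟶*-dev (var x)     = ε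
⟶*-dev unit        = ε
⟶*-dev nil         = ε
⟶*-dev cons        = ε
⟶*-dev lrec        = ε
⟶*-dev (lam t)     = ⟶*-lam (⟶*-dev t)
⟶*-dev (app t s)   = ⟶*-dev-app t s (⟶*-dev t) (⟶*-dev s)
⟶*-dev (catch t)   = ⟶*-catch (⟶*-dev t) ◅◅ ⟶*-contract _
⟶*-dev (throw α t) = ⟶*-throw (⟶*-dev t) ◅◅ ⟶*-contract _

dev-Value : ∀ {v} → Value v → Value (dev v)
dev-Value (v-var x)     = v-var x
dev-Value v-unit        = v-unit
dev-Value v-nil         = v-nil
dev-Value v-cons0       = v-cons0
dev-Value (v-cons1 v)   rewrite contract-Value (v-cons1 (dev-Value v)) = v-cons1 (dev-Value v)
dev-Value (v-cons2 v w) rewrite contract-Value (v-cons1 (dev-Value v))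
                              | contract-Value (v-cons2 (dev-Value v) (dev-Value w)) =
  v-cons2 (dev-Value v) (dev-Value w)
dev-Value v-lrec0       = v-lrec0
dev-Value (v-lrec1 v)   rewrite contract-Value (v-lrec1 (dev-Value v)) = v-lrec1 (dev-Value v)
dev-Value (v-lrec2 v w) rewrite contract-Value (v-lrec1 (dev-Value v))
                              | contract-Value (v-lrec2 (dev-Value v) (dev-Value w)) =
  v-lrec2 (dev-Value v) (dev-Value w)
dev-Value (v-lam r)     = v-lam _

dev-renV : ∀ π {ρ} → π ∘ ρ ≗ id → ∀ t → dev (renV ρ t) ≡ renV ρ (dev t)
dev-renV π inv (var x)     = refl
dev-renV π inv unit        = refl
dev-renV π inv nil         = refl
dev-renV π inv cons        = refl
dev-renV π inv lrec        = refl
dev-renV π inv (lam t)     = cong lam (dev-renV (ext π) (ext-inverse inv) t)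
dev-renV π inv (app t s)   =
  trans (cong₂ (λ a b → contract (app a b)) (dev-renV π inv t) (dev-renV π inv s))
        (sym (renV-contract π inv (app (dev t) (dev s))))
dev-renV π inv (catch t)   =
  trans (cong (contract ∘ catch) (dev-renV π inv t)) (sym (renV-contract π inv (catch (dev t))))
dev-renV π inv (throw α t) =
  trans (cong (contract ∘ throw α) (dev-renV π inv t))
        (sym (renV-contract π inv (throw α (dev t))))

dev-renK : ∀ π {ρ} → π ∘ ρ ≗ id → ∀ t → dev (renK ρ t) ≡ renK ρ (dev t)
dev-renK π inv (var x)     = refl
dev-renK π inv unit        = refl
dev-renK π inv nil         = refl
dev-renK π inv cons        = refl
dev-renK π inv lrec        = refl
dev-renK π inv (lam t)     = cong lam (dev-renK π inv t)
dev-renK π inv (app t s)   =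
  trans (cong₂ (λ a b → contract (app a b)) (dev-renK π inv t) (dev-renK π inv s))
        (sym (renK-contract π inv (app (dev t) (dev s))))
dev-renK π inv (catch t)   =
  trans (cong (contract ∘ catch) (dev-renK (ext π) (ext-inverse inv) t))
        (sym (renK-contract π inv (catch (dev t))))
dev-renK π {ρ} inv (throw α t) =
  trans (cong (contract ∘ throw (ρ α)) (dev-renK π inv t))
        (sym (renK-contract π inv (throw α (dev t))))

dev-weaken : ∀ t → dev (renK suc t) ≡ renK suc (dev t)
dev-weaken = dev-renK pred (λ _ → refl)

sub-dev : ∀ {σ τ} → ValueSub τ → (∀ x → τ x ⟶* dev (σ x)) →
          ∀ t → sub τ (dev t) ⟶* dev (sub σ t)
sub-dev τ-val p (var x)     = p x
sub-dev τ-val p unit        = ε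
sub-dev τ-val p nil         = ε
sub-dev τ-val p cons        = ε
sub-dev τ-val p lrec        = ε
sub-dev {σ} {τ} τ-val p (lam t) = ⟶*-lam (sub-dev (ValueSub-exts τ-val) p-exts t)
  where p-exts : ∀ x → exts τ x ⟶* dev (exts σ x)
        p-exts zero    = ε
        p-exts (suc n) =
          ⟶*-renV suc (p n) ◅◅ reflexive _⟶_ (sym (dev-renV pred (λ _ → refl) (σ n)))
sub-dev τ-val p (app t s)   =
  sub-contract τ-val (app (dev t) (dev s))
    ◅◅ contract-app-⟶* (sub-dev τ-val p t) (sub-dev τ-val p s)
sub-dev {σ} {τ} τ-val p (catch t) =
  sub-contract τ-val (catch (dev t))
    ◅◅ contract-catch-⟶* (sub-dev (ValueSub-weaken τ-val) p-weaken t)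
  where p-weaken : ∀ x → renK suc (τ x) ⟶* dev (renK suc (σ x))
        p-weaken x = ⟶*-renK suc (p x) ◅◅ reflexive _⟶_ (sym (dev-weaken (σ x)))
sub-dev τ-val p (throw α t) =
  sub-contract τ-val (throw α (dev t)) ◅◅ contract-throw-⟶* (sub-dev τ-val p t)

dev-lrec₂ : ∀ {vr vs} → Value vr → Value vs →
            dev (app (app lrec vr) vs) ≡ app (app lrec (dev vr)) (dev vs)
dev-lrec₂ a b rewrite contract-Value (v-lrec1 (dev-Value a)) =
  contract-Value (v-lrec2 (dev-Value a) (dev-Value b))

dev-cons₂ : ∀ {vh vt} → Value vh → Value vt → dev (vh ∷ₜ vt) ≡ dev vh ∷ₜ dev vt
dev-cons₂ c d rewrite contract-Value (v-cons1 (dev-Value c)) =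
  contract-Value (v-cons2 (dev-Value c) (dev-Value d))

dev-lrec-nil : ∀ {vr vs} → Value vr → Value vs →
               dev (app (app (app lrec vr) vs) nil) ≡ dev vr
dev-lrec-nil a b rewrite dev-lrec₂ a b = contract-↦ (↦-lrec-nil (dev-Value a) (dev-Value b))

dev-lrec-cons : ∀ {vr vs vh vt} → Value vr → Value vs → Value vh → Value vt →
                dev (app (app (app lrec vr) vs) (vh ∷ₜ vt))
                  ≡ app (app (app (dev vs) (dev vh)) (dev vt))
                        (app (app (app lrec (dev vr)) (dev vs)) (dev vt))
dev-lrec-cons a b c d rewrite dev-lrec₂ a b | dev-cons₂ c d =
  contract-↦ (↦-lrec-cons (dev-Value a) (dev-Value b) (dev-Value c) (dev-Value d))

dev-throw-appL : ∀ α t s → dev (app (throw α t) s) ≡ dev (throw α t)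
dev-throw-appL α t s with contract-throw α (dev t)
... | _ , _ , e rewrite e = contract-↦ (↦-throwL {s = dev s})

dev-throw-appR : ∀ α t {v} → Value v → dev (app v (throw α t)) ≡ dev (throw α t)
dev-throw-appR α t vv with contract-throw α (dev t)
... | _ , _ , e rewrite e = contract-↦ (↦-throwR (dev-Value vv))

dev-throw-throw : ∀ β α t → dev (throw β (throw α t)) ≡ dev (throw α t)
dev-throw-throw β α t with contract-throw α (dev t)
... | _ , _ , e rewrite e = contract-↦ (↦-throw {β = β})

dev-catch-val : ∀ {v} → Value v → dev (catch (renK suc v)) ≡ dev v
dev-catch-val {v} vv = begin
  contract (catch (dev (renK suc v)))
    ≡⟨ cong (contract ∘ catch) (dev-weaken v) ⟩
  contract (catch (renK suc (dev v)))
    ≡⟨ contract-↦ (↦-catch-val weakened (#-weaken (dev v))) ⟩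
  strengthen (renK suc (dev v))
    ≡⟨ strengthen-weaken (dev v) ⟩
  dev v
    ∎
  where
  open ≡-Reasoning
  weakened = Value-renK suc (dev-Value vv)

dev-catch-other : ∀ β {v} → Value v →
                  dev (catch (throw (suc β) (renK suc v))) ≡ dev (throw β v)
dev-catch-other β {v} vv = begin
  contract (catch (contract (throw (suc β) (dev (renK suc v)))))
    ≡⟨ cong (λ w → contract (catch (contract (throw (suc β) w)))) (dev-weaken v) ⟩
  contract (catch (contract (throw (suc β) (renK suc (dev v)))))
    ≡⟨ cong (contract ∘ catch) (contract-throw-Value weakened) ⟩
  contract (catch (throw (suc β) (renK suc (dev v))))
    ≡⟨ contract-↦ (↦-catch-other weakened (#-weaken (dev v))) ⟩
  throw β (strengthen (renK suc (dev v)))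
    ≡⟨ cong (throw β) (strengthen-weaken (dev v)) ⟩
  throw β (dev v)
    ≡⟨ sym (contract-throw-Value (dev-Value vv)) ⟩
  contract (throw β (dev v))
    ∎
  where
  open ≡-Reasoning
  weakened = Value-renK suc (dev-Value vv)

Z : Tm → Tm → Set
Z t t' = t' ⟶* dev t × dev t ⟶* dev t'

Z-by-≡ : ∀ {t t'} → dev t ≡ dev t' → Z t t'
Z-by-≡ {t' = t'} e = ⟶*-dev t' ◅◅ reflexive _⟶_ (sym e) , reflexive _⟶_ e

Z-β : ∀ t {v} → Value v → Z (app (lam t) v) (t [ v ])
Z-β t {v} vv =
  ⟶*-sub (ValueSub-single vv) (⟶*-dev t) ◅◅ sub-⟶* v⟶*dev (dev t)
    ◅◅ reflexive _⟶_ (sym contracted) ,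
  reflexive _⟶_ contracted ◅◅ sub-dev (ValueSub-single (dev-Value vv)) dev-single t
  where
  contracted = contract-↦ (↦-β {dev t} (dev-Value vv))
  v⟶*dev : ∀ x → single v x ⟶* single (dev v) x
  v⟶*dev zero    = ⟶*-dev v
  v⟶*dev (suc n) = ε
  dev-single : ∀ x → single (dev v) x ⟶* dev (single v x)
  dev-single zero    = ε
  dev-single (suc n) = ε

Z-catch-throw : ∀ t → Z (catch (throw zero t)) (catch t)
Z-catch-throw t with contract-catch-throw (dev t)
... | p , q = ⟶*-catch (⟶*-dev t) ◅◅ p , q

Z-lrec-cons : ∀ {vr vs vh vt} → Value vr → Value vs → Value vh → Value vt →
              Z (app (app (app lrec vr) vs) (vh ∷ₜ vt))
                (app (app (app vs vh) vt) (app (app (app lrec vr) vs) vt))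
Z-lrec-cons {vr} {vs} {vh} {vt} a b c d rewrite dev-lrec-cons a b c d =
  ⟶*-app (⟶*-app (⟶*-app (⟶*-dev vs) (⟶*-dev vh)) (⟶*-dev vt))
         (⟶*-app (⟶*-app (⟶*-app ε (⟶*-dev vr)) (⟶*-dev vs)) (⟶*-dev vt)) ,
  ⟶*-dev-app (app (app vs vh) vt) (app (app (app lrec vr) vs) vt) step recursion
  where
  step : app (app (dev vs) (dev vh)) (dev vt) ⟶* dev (app (app vs vh) vt)
  step = ⟶*-dev-app (app vs vh) vt (⟶*-contract _) ε
  recursion : app (app (app lrec (dev vr)) (dev vs)) (dev vt)
                ⟶* dev (app (app (app lrec vr) vs) vt)
  recursion =
    ⟶*-dev-app (app (app lrec vr) vs) vt (⟶*-dev-app (app lrec vr) vs (⟶*-contract _) ε) ε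

dev-Z : ∀ {t t'} → t ⟶ t' → Z t t'
dev-Z (β-lam {t} vv)                = Z-β t vv
dev-Z (throw-appL {α} {t} {s})      = Z-by-≡ {app (throw α t) s} (dev-throw-appL α t s)
dev-Z (throw-appR {v} {α} {t} vv)   = Z-by-≡ {app v (throw α t)} (dev-throw-appR α t vv)
dev-Z (throw-throw {β} {α} {t})     = Z-by-≡ {throw β (throw α t)} (dev-throw-throw β α t)
dev-Z (catch-throw {t})             = Z-catch-throw t
dev-Z (catch-other {β} {v} vv)      =
  Z-by-≡ {catch (throw (suc β) (renK suc v))} (dev-catch-other β vv)
dev-Z (catch-val {v} vv)            = Z-by-≡ {catch (renK suc v)} (dev-catch-val vv)
dev-Z (lrec-nil {vr} {vs} a b)      =
  Z-by-≡ {app (app (app lrec vr) vs) nil} (dev-lrec-nil a b)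
dev-Z (lrec-cons a b c d)           = Z-lrec-cons a b c d
dev-Z (ξ-lam s) with dev-Z s
... | p , q = ⟶*-lam p , ⟶*-lam q
dev-Z (ξ-appL {t} {s = s} st) with dev-Z st
... | p , q = ⟶*-dev-app t s p (⟶*-dev s) , contract-app-⟶* {b = dev s} q ε
dev-Z (ξ-appR {t} {s} st) with dev-Z st
... | p , q = ⟶*-dev-app t s (⟶*-dev t) p , contract-app-⟶* {a = dev t} ε q
dev-Z (ξ-catch s) with dev-Z s
... | p , q = ⟶*-catch p ◅◅ ⟶*-contract _ , contract-catch-⟶* q
dev-Z (ξ-throw s) with dev-Z s
... | p , q = ⟶*-throw p ◅◅ ⟶*-contract _ , contract-throw-⟶* q

theorem3p10 : ∀ {t₁ t₂ t₃ : Tm} → t₁ ⟶* t₂ → t₁ ⟶* t₃ →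
              ∃ λ (t₄ : Tm) → (t₂ ⟶* t₄) × (t₃ ⟶* t₄)
theorem3p10 = Z⇒confluent dev ⟶*-dev dev-Z
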